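{- Let $p\ge 2$ and let $a=(a_n)_{n\ge1}$ be a $p$-automatic sequence. (1) For every integer $r$ with $0\le r<p$, there exists $u\in N(a)$ such that $\operatorname{rel}(u)$ contains a relation of type $r$. (2) If $a$ is homogeneous, then $a$ has global relations of all types.
   Context: Sequences are indexed from $n=1$. A $p$-automaton consists of a finite set of states, an initial state, a labeling map from the states to a finite alphabet, and for each state and each $i\in\{0,\dots,p-1\}$ exactly one outgoing arrow labeled $i$; it produces the sequence $(a_n)_{n\ge1}$ where $a_n$ is the label of the state reached from the initial state by following the arrows labeled by the base-$p$ digits of $n$, read from right (least significant) to left. A sequence is $p$-automatic if some $p$-automaton produces it. For a sequence $a$ and integers $i,j\ge0$ with $j<p^i$, $a^{(i,j)}=(a_{p^in+j})_{n\ge1}$, and $N(a)=\{a^{(i,j)}: i,j\ge 0,\ j<p^i\}$. A relation for $a$ is a pair $(i,j)$ with $i,j\ge 0$, $j<p^i$, $(i,j)\ne(0,0)$ and $a^{(i,j)}=a$; $\operatorname{rel}(a)$ is the set of relations of $a$. The type of a relation $(i,j)$ (necessarily $i\ge1$) is the leftmost digit of the word obtained by writing $j$ in base $p$ and padding it with zeros on the left to have exactly $i$ digits. A pair $(i,j)$ is a global relation for $a$ if $(i,j)\in\bigcap_{u\in N(a)}\operatorname{rel}(u)$; $a$ has global relations of all types if for each $r\in\{0,\dots,p-1\}$ there is a global relation of type $r$. The sequence $a$ is homogeneous if for every $u\in N(a)$ one has $N(u)=N(a)$ and $\operatorname{rel}(u)=\operatorname{rel}(a)$. -}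

module Defs where

open import Data.Nat using (ℕ; zero; suc; _+_; _*_; _^_; _≤_; _<_; NonZero)
open import Data.Nat.Properties using (m^n≢0)
open import Data.Nat.DivMod using (_/_; _mod_)
open import Data.Fin using (Fin)
open import Data.List using (List; []; _∷_)
open import Data.Product using (Σ; ∃; ∃-syntax; _×_; _,_)
open import Relation.Binary.PropositionalEquality using (_≡_)
open import Relation.Nullary using (¬_)
open import Function.Bundles using (_⇔_)

-- A sequence (a_n)_{n ≥ 1} over an alphabet A is a function ℕ → A;
-- the value at 0 is irrelevant (all notions below only look at n ≥ 1).
Seq : Set → Set
Seq A = ℕ → A

_≈_ : {A : Set} → Seq A → Seq A → Set
u ≈ v = ∀ n → 1 ≤ n → u n ≡ v n

module _ (p : ℕ) .{{_ : NonZero p}} where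

  -- base-p digits of n, least significant first (no leading zeros;
  -- empty for n = 0). The first argument is fuel; fuel n suffices for p ≥ 2.
  digitsF : ℕ → ℕ → List (Fin p)
  digitsF zero    n       = []
  digitsF (suc f) zero    = []
  digitsF (suc f) (suc m) = (suc m mod p) ∷ digitsF f (suc m / p)

  digits : ℕ → List (Fin p)
  digits n = digitsF n n

record Automaton (p : ℕ) (A : Set) : Set where
  field
    k       : ℕ
    initial : Fin k
    label   : Fin k → A
    δ       : Fin k → Fin p → Fin k

reach : ∀ {p A} (M : Automaton p A) → Fin (Automaton.k M) → List (Fin p) → Fin (Automaton.k M)
reach M s []       = s
reach M s (d ∷ ds) = reach M (Automaton.δ M s d) ds

-- the sequence produced by the automaton (digits read from right to left)
output : ∀ {A} (p : ℕ) .{{_ : NonZero p}} → Automaton p A → Seq A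
output p M n = Automaton.label M (reach M (Automaton.initial M) (digits p n))

IsAutomatic : ∀ {A} (p : ℕ) .{{_ : NonZero p}} → Seq A → Set
IsAutomatic {A} p a = Σ (Automaton p A) λ M → output p M ≈ a

-- (i,j) has type r: leftmost digit of j written in base p with exactly
-- i digits (left zero padding), i.e. j / p^(i-1); only i ≥ 1 has a type.
HasType : (p : ℕ) .{{_ : NonZero p}} → ℕ → ℕ → ℕ → Set
HasType p i j r = Σ ℕ λ i' → i ≡ suc i' × (_/_ j (p ^ i') {{m^n≢0 p i'}}) ≡ r

module _ {A : Set} (p : ℕ) .{{_ : NonZero p}} where

  sub : Seq A → ℕ → ℕ → Seq A
  sub a i j n = a (p ^ i * n + j)

  InN : Seq A → Seq A → Set
  InN a u = ∃[ i ] ∃[ j ] (j < p ^ i × u ≈ sub a i j)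

  Rel : Seq A → ℕ → ℕ → Set
  Rel a i j = j < p ^ i × ¬ (i ≡ 0 × j ≡ 0) × sub a i j ≈ a


  GlobalRel : Seq A → ℕ → ℕ → Set
  GlobalRel a i j = ∀ u → InN a u → Rel u i j

  HasGlobalRelsAllTypes : Seq A → Set
  HasGlobalRelsAllTypes a = ∀ r → r < p → ∃[ i ] ∃[ j ] (GlobalRel a i j × HasType p i j r)

  Homogeneous : Seq A → Set
  Homogeneous a = ∀ u → InN a u →
    (∀ v → InN u v ⇔ InN a v) × (∀ i j → Rel u i j ⇔ Rel a i j)

-- Follow the arrow labelled r from the initial state: among the first k + 1
-- states visited some state repeats, say after m steps and again after m + l + 1.
-- Reading the repdigit rr…r (m digits) below the digits of n lands in the
-- state reached after m steps, so u = a^(m, rr…r) is produced from that state,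
-- and the loop of length l + 1 gives the relation (l + 1, rr…r) of u, of type r.
-- For a homogeneous a every element of N(a) has the same relations as a, so
-- a relation found in some u ∈ N(a) is global.
module Submission where

open import Defs
open import Data.Nat using (ℕ; zero; suc; _+_; _*_; _^_; _≤_; _<_; NonZero; >-nonZero⁻¹; s≤s; z≤n; _%_; _/_)
open import Data.Nat.Properties
open import Data.Nat.DivMod
open import Data.Nat.Divisibility using (n∣m*n)
open import Data.Nat.GeneralisedArithmetic using (iterate)
open import Data.Nat.Solver using (module +-*-Solver)
open import Data.Fin using (Fin; toℕ; fromℕ<)
open import Data.Fin.Properties using (toℕ-injective; toℕ-fromℕ<; toℕ<n; pigeonhole)
open import Data.List using (_∷_)
open import Data.Product using (∃-syntax; ∃₂; _×_; _,_; proj₂)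
open import Relation.Binary.PropositionalEquality using (_≡_; refl; sym; trans; cong; cong₂; subst; module ≡-Reasoning)
open import Function.Base using (_∘_)
open import Function.Bundles using (Equivalence)

open +-*-Solver using (solve; _:=_; _:+_; _:*_; con)

[m+kn]/n≡k : ∀ {m} k n .{{_ : NonZero n}} → m < n → (m + k * n) / n ≡ k
[m+kn]/n≡k {m} k n m<n = begin
  (m + k * n) / n     ≡⟨ +-distrib-/-∣ʳ m (n∣m*n k) ⟩
  m / n + k * n / n   ≡⟨ cong₂ _+_ (m<n⇒m/n≡0 m<n) (m*n/n≡m k n) ⟩
  k                   ∎
  where open ≡-Reasoning

iterate-+ : ∀ {S : Set} (f : S → S) s m l → iterate f s (m + l) ≡ iterate f (iterate f s m) l
iterate-+ f s zero    l = refl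
iterate-+ f s (suc m) l = iterate-+ f (f s) m l

iterate-eventually-periodic : ∀ {k} (f : Fin k → Fin k) s →
  ∃₂ λ m l → iterate f (iterate f s m) (suc l) ≡ iterate f s m
iterate-eventually-periodic {k} f s
  with i , j , i<j , fⁱs≡fʲs ← pigeonhole (n<1+n k) (iterate f s ∘ toℕ)
  with l , i+1+l≡j ← m≤n⇒∃[o]m+o≡n i<j
  = toℕ i , l , (begin
    iterate f (iterate f s (toℕ i)) (suc l) ≡⟨ iterate-+ f s (toℕ i) (suc l) ⟨
    iterate f s (toℕ i + suc l)             ≡⟨ cong (iterate f s) (trans (+-suc (toℕ i) l) i+1+l≡j) ⟩
    iterate f s (toℕ j)                     ≡⟨ fⁱs≡fʲs ⟨
    iterate f s (toℕ i)                     ∎)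
  where open ≡-Reasoning

module _ {A : Set} (p : ℕ) .{{_ : NonZero p}} where

  HasRelationOfTypeInN : Seq A → ℕ → Set
  HasRelationOfTypeInN a r = ∃[ u ] (InN p a u × ∃[ i ] ∃[ j ] (Rel p u i j × HasType p i j r))

module _ (p : ℕ) .{{_ : NonZero p}} where

  repdigit : Fin p → ℕ → ℕ
  repdigit r zero    = 0
  repdigit r (suc m) = toℕ r + repdigit r m * p

  repdigit<p^m : ∀ r m → repdigit r m < p ^ m
  repdigit<p^m r zero    = s≤s z≤n
  repdigit<p^m r (suc m) = begin-strict
    toℕ r + repdigit r m * p  <⟨ +-monoˡ-< (repdigit r m * p) (toℕ<n r) ⟩
    p + repdigit r m * p      ≡⟨⟩
    suc (repdigit r m) * p    ≤⟨ *-monoˡ-≤ p (repdigit<p^m r m) ⟩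
    p ^ m * p                 ≡⟨ *-comm (p ^ m) p ⟩
    p ^ suc m                 ∎
    where open ≤-Reasoning

  repdigit-suc : ∀ r m → repdigit r (suc m) ≡ repdigit r m + toℕ r * p ^ m
  repdigit-suc r zero    = solve 2 (λ r p → r :+ con 0 :* p := con 0 :+ r :* con 1) refl (toℕ r) p
  repdigit-suc r (suc m) = begin
    toℕ r + (toℕ r + repdigit r m * p) * p      ≡⟨ cong (λ j → toℕ r + j * p) (repdigit-suc r m) ⟩
    toℕ r + (repdigit r m + toℕ r * p ^ m) * p
      ≡⟨ solve 4 (λ r j x p → r :+ (j :+ r :* x) :* p := (r :+ j :* p) :+ r :* (p :* x))
           refl (toℕ r) (repdigit r m) (p ^ m) p ⟩
    (toℕ r + repdigit r m * p) + toℕ r * p ^ suc m ∎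
    where open ≡-Reasoning

  repdigit-leading : ∀ r m → _/_ (repdigit r (suc m)) (p ^ m) {{m^n≢0 p m}} ≡ toℕ r
  repdigit-leading r m = trans (cong (_/ p ^ m) (repdigit-suc r m)) ([m+kn]/n≡k (toℕ r) (p ^ m) (repdigit<p^m r m))
    where
      instance
        p^m≢0 : NonZero (p ^ m)
        p^m≢0 = m^n≢0 p m

  repdigit-hasType : ∀ r m → HasType p (suc m) (repdigit r (suc m)) (toℕ r)
  repdigit-hasType r m = m , refl , repdigit-leading r m

  1≤p^i*n+j : ∀ i j {n} → 1 ≤ n → 1 ≤ p ^ i * n + j
  1≤p^i*n+j i j {n} 1≤n = ≤-trans (*-mono-≤ (m^n>0 p i) 1≤n) (m≤m+n (p ^ i * n) j)

module _ (p : ℕ) .{{_ : NonZero p}} (1<p : 1 < p) where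

  digitsF-fuel-irrelevant : ∀ f g n → n ≤ f → n ≤ g → digitsF p f n ≡ digitsF p g n
  digitsF-fuel-irrelevant zero    zero    zero    _ _ = refl
  digitsF-fuel-irrelevant zero    (suc g) zero    _ _ = refl
  digitsF-fuel-irrelevant (suc f) zero    zero    _ _ = refl
  digitsF-fuel-irrelevant (suc f) (suc g) zero    _ _ = refl
  digitsF-fuel-irrelevant (suc f) (suc g) (suc m) (s≤s m≤f) (s≤s m≤g) =
    cong (suc m mod p ∷_) (digitsF-fuel-irrelevant f g (suc m / p) (quotient≤ m≤f) (quotient≤ m≤g))
    where
      quotient≤ : ∀ {h} → m ≤ h → suc m / p ≤ h
      quotient≤ m≤h = ≤-pred (≤-trans (m/n<m (suc m) p 1<p) (s≤s m≤h))

  digits-suc : ∀ m → digits p (suc m) ≡ (suc m mod p) ∷ digits p (suc m / p)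
  digits-suc m = cong (suc m mod p ∷_)
    (digitsF-fuel-irrelevant m (suc m / p) (suc m / p) (≤-pred (m/n<m (suc m) p 1<p)) ≤-refl)

  [d+n*p]mod-p≡d : ∀ (d : Fin p) n → (toℕ d + n * p) mod p ≡ d
  [d+n*p]mod-p≡d d n = toℕ-injective (begin
    toℕ ((toℕ d + n * p) mod p) ≡⟨ toℕ-fromℕ< _ ⟩
    (toℕ d + n * p) % p         ≡⟨ [m+kn]%n≡m%n (toℕ d) n p ⟩
    toℕ d % p                   ≡⟨ m<n⇒m%n≡m (toℕ<n d) ⟩
    toℕ d                       ∎)
    where open ≡-Reasoning

  digits-d+n*p : ∀ (d : Fin p) n → 1 ≤ n → digits p (toℕ d + n * p) ≡ d ∷ digits p n
  digits-d+n*p d n 1≤n with toℕ d + n * p in eq | ≤-trans (*-mono-≤ 1≤n (>-nonZero⁻¹ p)) (m≤n+m (n * p) (toℕ d))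
  ... | zero  | ()
  ... | suc m | _  = begin
    digits p (suc m)                      ≡⟨ digits-suc m ⟩
    (suc m mod p) ∷ digits p (suc m / p)  ≡⟨ cong₂ _∷_ (trans (cong (_mod p) (sym eq)) ([d+n*p]mod-p≡d d n))
                                                       (cong (digits p) (trans (cong (_/ p) (sym eq)) ([m+kn]/n≡k n p (toℕ<n d)))) ⟩
    d ∷ digits p n                        ∎
    where open ≡-Reasoning

  module _ {A : Set} (M : Automaton p A) where
    open Automaton M

    outputFrom : Fin k → Seq A
    outputFrom s n = label (reach M s (digits p n))

    outputFrom-digit : ∀ s (d : Fin p) n → 1 ≤ n → outputFrom s (toℕ d + n * p) ≡ outputFrom (δ s d) n
    outputFrom-digit s d n 1≤n = cong (label ∘ reach M s) (digits-d+n*p d n 1≤n)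

    outputFrom-repdigit : ∀ r m s n → 1 ≤ n →
      outputFrom s (p ^ m * n + repdigit p r m) ≡ outputFrom (iterate (λ t → δ t r) s m) n
    outputFrom-repdigit r zero    s n _   = cong (outputFrom s) (trans (+-identityʳ _) (*-identityˡ n))
    outputFrom-repdigit r (suc m) s n 1≤n = begin
      outputFrom s (p ^ suc m * n + repdigit p r (suc m))
        ≡⟨ cong (outputFrom s) (solve 5 (λ p x n r j → p :* x :* n :+ (r :+ j :* p) := r :+ (x :* n :+ j) :* p)
                                  refl p (p ^ m) n (toℕ r) (repdigit p r m)) ⟩
      outputFrom s (toℕ r + (p ^ m * n + repdigit p r m) * p)
        ≡⟨ outputFrom-digit s r _ (1≤p^i*n+j p m (repdigit p r m) 1≤n) ⟩
      outputFrom (δ s r) (p ^ m * n + repdigit p r m)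
        ≡⟨ outputFrom-repdigit r m (δ s r) n 1≤n ⟩
      outputFrom (iterate (λ t → δ t r) (δ s r) m) n ∎
      where open ≡-Reasoning

    repdigit-relation : (a : Seq A) → output p M ≈ a → ∀ r m l →
      let s = iterate (λ t → δ t r) initial m in
      iterate (λ t → δ t r) s (suc l) ≡ s →
      Rel p (sub p a m (repdigit p r m)) (suc l) (repdigit p r (suc l))
    repdigit-relation a M≈a r m l loop = repdigit<p^m p r (suc l) , (λ { (() , _) }) , periodic
      where
        δʳ : Fin k → Fin k
        δʳ t = δ t r
        J : ℕ → ℕ
        J = repdigit p r
        s : Fin k
        s = iterate δʳ initial m
        periodic : sub p (sub p a m (J m)) (suc l) (J (suc l)) ≈ sub p a m (J m)
        periodic n 1≤n = begin
          a (p ^ m * (p ^ suc l * n + J (suc l)) + J m)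
            ≡⟨ M≈a _ (1≤p^i*n+j p m (J m) 1≤p^l+1*n+J) ⟨
          outputFrom initial (p ^ m * (p ^ suc l * n + J (suc l)) + J m)
            ≡⟨ outputFrom-repdigit r m initial _ 1≤p^l+1*n+J ⟩
          outputFrom s (p ^ suc l * n + J (suc l))
            ≡⟨ outputFrom-repdigit r (suc l) s n 1≤n ⟩
          outputFrom (iterate δʳ s (suc l)) n
            ≡⟨ cong (λ t → outputFrom t n) loop ⟩
          outputFrom s n
            ≡⟨ outputFrom-repdigit r m initial n 1≤n ⟨
          outputFrom initial (p ^ m * n + J m)
            ≡⟨ M≈a _ (1≤p^i*n+j p m (J m) 1≤n) ⟩
          a (p ^ m * n + J m) ∎
          where
            open ≡-Reasoning
            1≤p^l+1*n+J : 1 ≤ p ^ suc l * n + J (suc l)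
            1≤p^l+1*n+J = 1≤p^i*n+j p (suc l) (J (suc l)) 1≤n

  automatic⇒relation-of-type : ∀ {A} (a : Seq A) → IsAutomatic p a →
    (r : Fin p) → HasRelationOfTypeInN p a (toℕ r)
  automatic⇒relation-of-type a (M , M≈a) r
    with m , l , loop ← iterate-eventually-periodic (λ t → Automaton.δ M t r) (Automaton.initial M)
    = sub p a m (repdigit p r m) , (m , repdigit p r m , repdigit<p^m p r m , λ _ _ → refl)
    , suc l , repdigit p r (suc l) , repdigit-relation M a M≈a r m l loop , repdigit-hasType p r l

module _ {A : Set} (p : ℕ) .{{_ : NonZero p}} {a : Seq A} where

  homogeneous⇒relation-global : Homogeneous p a → ∀ {u i j} → InN p a u → Rel p u i j → GlobalRel p a i j
  homogeneous⇒relation-global hom u∈N rel v v∈N =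
    Equivalence.from (proj₂ (hom v v∈N) _ _) (Equivalence.to (proj₂ (hom _ u∈N) _ _) rel)

  homogeneous⇒global-relations-of-all-types : Homogeneous p a →
    (∀ r → r < p → HasRelationOfTypeInN p a r) → HasGlobalRelsAllTypes p a
  homogeneous⇒global-relations-of-all-types hom relationOfType r r<p
    with _ , u∈N , i , j , rel , type ← relationOfType r r<p
    = i , j , homogeneous⇒relation-global hom u∈N rel , type

mainTheorem2 : {A : Set} (p : ℕ) .{{_ : NonZero p}} → 2 ≤ p →
    (a : Seq A) → IsAutomatic p a →
    (∀ r → r < p → ∃[ u ] (InN p a u × ∃[ i ] ∃[ j ] (Rel p u i j × HasType p i j r)))
    × (Homogeneous p a → HasGlobalRelsAllTypes p a)
mainTheorem2 p 1<p a automatic =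
  relationOfType , λ hom → homogeneous⇒global-relations-of-all-types p hom relationOfType
  where
    relationOfType : ∀ r → r < p → HasRelationOfTypeInN p a r
    relationOfType r r<p =
      subst (HasRelationOfTypeInN p a) (toℕ-fromℕ< r<p) (automatic⇒relation-of-type p 1<p a automatic (fromℕ< r<p))
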